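{- Let $\mu=(\mu_0,\mu_1,\dotsc,\mu_\ell)$ be an integer partition with $\ell\geq1$, $1\leq d\leq\mu_0$, $\mu_\ell=1$ and $\mu_{\ell-1}\geq d$. Then \[ \sum_{n\geq0}S_{\mu,d,n}(s_1,\dotsc,s_d)x^n=\frac{1}{1-x\prod_{r=1}^{d}(1+s_rx^\ell)}. \] In particular, setting $s_1=s$ and $s_2=\cdots=s_d=1$ gives $\dfrac{1}{1-x(1+x^\ell)^{d-1}(1+sx^\ell)}$.
   Context: An anchor word for $\mu$ of length $n$ is a word $a_1\cdots a_n$ over $\{1,\dotsc,d,\infty\}$ such that $a_i\neq\infty$ implies $a_{i+k}\geq a_i+\mu_k$ for $k=1,\dotsc,\ell$ ($\infty$ larger than every integer) and $a_{n-\ell+1}=\cdots=a_n=\infty$. $S_{\mu,d,n}(s_1,\dotsc,s_d)=\sum_w\prod_{i:\,a_i\neq\infty}s_{a_i}$, the sum over all anchor words $w=a_1\cdots a_n$ of length $n$. -}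

module Defs where

open import Level using (Level)
open import Algebra.Bundles using (CommutativeRing)
open import Data.Nat using (ℕ; zero; suc; _+_; _∸_; _≤_; _≤?_)
import Data.Nat.Properties as ℕP
open import Data.Fin using (Fin; toℕ)
import Data.Fin as Fin
open import Data.Fin.Properties using (all?)
open import Data.Maybe using (Maybe; just; nothing)
open import Data.Vec using (Vec; []; _∷_; lookup)
open import Data.List using (List; []; _∷_; map; concatMap; foldr; allFin)
open import Data.Product using (_×_; _,_)
open import Data.Unit using (⊤; tt)
open import Relation.Binary.PropositionalEquality using (_≡_)
open import Relation.Nullary using (Dec; yes; no)
open import Relation.Nullary.Decidable using (_×-dec_; _→-dec_)

-- A letter is  just a  (a : Fin d, standing for the integer 1 + toℕ a ∈ {1,…,d})
-- or  nothing  (standing for ∞).  Positions are 0-indexed: position i here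
-- is position i+1 of the paper.

val : ∀ {d} → Fin d → ℕ
val a = suc (toℕ a)

-- "a_i ≠ ∞ implies a_{i+k} ≥ a_i + m"  (∞ is larger than every integer)
StepCond : ∀ {d} → Maybe (Fin d) → Maybe (Fin d) → ℕ → Set
StepCond nothing  _        _ = ⊤
StepCond (just a) nothing  _ = ⊤
StepCond (just a) (just b) m = val a + m ≤ val b

stepCond? : ∀ {d} (x y : Maybe (Fin d)) (m : ℕ) → Dec (StepCond x y m)
stepCond? nothing  _        _ = yes tt
stepCond? (just a) nothing  _ = yes tt
stepCond? (just a) (just b) m = val a + m ≤? val b

IsInfty : ∀ {d} → Maybe (Fin d) → Set
IsInfty nothing  = ⊤
IsInfty (just _) = Data.Empty.⊥
  where import Data.Empty

isInfty? : ∀ {d} (x : Maybe (Fin d)) → Dec (IsInfty x)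
isInfty? nothing  = yes tt
isInfty? (just _) = no (λ ())

IsAnchor : ∀ {ℓ} (μ : Fin (suc ℓ) → ℕ) (d n : ℕ) → Vec (Maybe (Fin d)) n → Set
IsAnchor {ℓ} μ d n w =
  (∀ (i j : Fin n) (k : Fin (suc ℓ)) → 1 ≤ toℕ k → toℕ j ≡ toℕ i + toℕ k →
     StepCond (lookup w i) (lookup w j) (μ k))
  ×
  (∀ (i : Fin n) → n ≤ toℕ i + ℓ → IsInfty (lookup w i))

isAnchor? : ∀ {ℓ} (μ : Fin (suc ℓ) → ℕ) (d n : ℕ) (w : Vec (Maybe (Fin d)) n) →
            Dec (IsAnchor μ d n w)
isAnchor? {ℓ} μ d n w =
  all? (λ i → all? (λ j → all? (λ k →
    (1 ≤? toℕ k) →-dec ((toℕ j Data.Nat.≟ toℕ i + toℕ k) →-dec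
       stepCond? (lookup w i) (lookup w j) (μ k)))))
  ×-dec
  all? (λ i → (n ≤? toℕ i + ℓ) →-dec isInfty? (lookup w i))

letters : (d : ℕ) → List (Maybe (Fin d))
letters d = nothing ∷ map just (allFin d)

allWords : (d n : ℕ) → List (Vec (Maybe (Fin d)) n)
allWords d zero    = [] ∷ []
allWords d (suc n) = concatMap (λ a → map (a ∷_) (allWords d n)) (letters d)

module Series {c ℓr : Level} (R : CommutativeRing c ℓr) where
  open CommutativeRing R using (Carrier; _≈_; _*_; _-_; 0#; 1#)
  open CommutativeRing R using () renaming (_+_ to _+ᴿ_)

  weight : ∀ {d n} → (Fin d → Carrier) → Vec (Maybe (Fin d)) n → Carrier
  weight s []             = 1#
  weight s (nothing ∷ w)  = weight s w
  weight s (just a ∷ w)   = s a * weight s w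

  S : ∀ {ℓ} (μ : Fin (suc ℓ) → ℕ) (d n : ℕ) → (Fin d → Carrier) → Carrier
  S μ d n s = foldr (λ w acc → addIf (isAnchor? μ d n w) (weight s w) acc) 0# (allWords d n)
    where
      addIf : ∀ {P : Set} → Dec P → Carrier → Carrier → Carrier
      addIf (yes _) x acc = x +ᴿ acc
      addIf (no _)  _ acc = acc

  PS : Set c
  PS = ℕ → Carrier

  sumTo : ℕ → (ℕ → Carrier) → Carrier
  sumTo zero    f = f zero
  sumTo (suc n) f = sumTo n f +ᴿ f (suc n)

  oneS : PS
  oneS zero    = 1#
  oneS (suc _) = 0#

  xPow : ℕ → PS
  xPow k n with k Data.Nat.≟ n
  ... | yes _ = 1#
  ... | no  _ = 0#

  _⊕_ : PS → PS → PS
  (f ⊕ g) n = f n +ᴿ g n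

  _⊖_ : PS → PS → PS
  (f ⊖ g) n = f n - g n

  _·_ : Carrier → PS → PS
  (a · f) n = a * f n

  _⊛_ : PS → PS → PS
  (f ⊛ g) n = sumTo n (λ i → f i * g (n ∸ i))

  prodS : ∀ {A : Set} → (A → PS) → List A → PS
  prodS f = foldr (λ r acc → f r ⊛ acc) oneS

  powS : PS → ℕ → PS
  powS f zero    = oneS
  powS f (suc k) = f ⊛ powS f k

  -- F equals 1/G as formal power series, i.e. G · F = 1
  -- (G has constant term 1 in all uses, so the reciprocal is unique)
  IsReciprocal : PS → PS → Set ℓr
  IsReciprocal F G = ∀ n → (G ⊛ F) n ≈ oneS n

  specS : ∀ {d′} → Carrier → Fin (suc d′) → Carrier
  specS s₀ Fin.zero    = s₀
  specS s₀ (Fin.suc _) = 1#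

{-# OPTIONS --safe #-}
-- For μ as in the theorem, a word is an anchor word iff each finite letter a is followed by
-- ℓ - 1 letters ∞ and then by ∞ or by a letter b > a.  Let F(n) be the weighted count of anchor
-- words of length n and V_a(n) that of the words w of length n for which a w is an anchor word.
-- Splitting off the first letter gives F(n+1) = F(n) + Σ_a s_a V_a(n) and
-- V_a = x^ℓ (F + Σ_{b>a} s_b V_b); solving this triangular system from the largest letter down
-- gives F + Σ_a s_a V_a = ∏_a (1 + s_a x^ℓ) F, that is, F = 1 + x ∏_a (1 + s_a x^ℓ) F.
module Submission where

open import Defs
open import Level using (Level)
open import Algebra.Bundles using (CommutativeRing)
open import Data.Nat using (ℕ; zero; suc; _≤_)
open import Data.Fin using (Fin; toℕ; zero; suc)
open import Data.List using (allFin)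
open import Data.Product using (_×_)
open import Relation.Binary.PropositionalEquality using (_≡_)

open import Data.Bool using (Bool; true; false)
open import Data.Empty using (⊥; ⊥-elim)
open import Data.Fin using (_<_; fromℕ; fromℕ<)
open import Data.Fin.Properties using (_<?_; toℕ<n; toℕ-fromℕ; toℕ-fromℕ<)
open import Data.List using (List; tabulate)
import Data.List as List
open import Data.Maybe using (Maybe; just; nothing)
import Data.Nat as ℕ
import Data.Nat.Properties as ℕ
open import Data.Product using (Σ; _,_; proj₁)
open import Data.Sum using (inj₁; inj₂)
open import Data.Unit using (⊤; tt)
open import Data.Vec using (Vec; []; _∷_; lookup)
open import Function using (_∘_; _⇔_; mk⇔)
open import Relation.Binary.PropositionalEquality using (_≢_)
import Relation.Binary.PropositionalEquality as ≡
open import Relation.Nullary using (Dec; yes; no; does)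
open import Relation.Nullary.Decidable using (_×-dec_; does-⇔; dec-true; dec-false)

Word : ℕ → ℕ → Set
Word d n = Vec (Maybe (Fin d)) n

module _ {d : ℕ} where

  Above : Fin d → Maybe (Fin d) → Set
  Above a nothing  = ⊤
  Above a (just x) = a < x

  above? : ∀ a z → Dec (Above a z)
  above? a nothing  = yes tt
  above? a (just x) = a <? x

  After : ∀ {n} → Fin d → ℕ → Word d n → Set
  After a j       []            = ⊥
  After a zero    (z ∷ _)       = Above a z
  After a (suc j) (nothing ∷ w) = After a j w
  After a (suc j) (just _ ∷ _)  = ⊥

  after? : ∀ {n} a j (w : Word d n) → Dec (After a j w)
  after? a j       []            = no λ ()
  after? a zero    (z ∷ _)       = above? a z
  after? a (suc j) (nothing ∷ w) = after? a j w
  after? a (suc j) (just _ ∷ _)  = no λ ()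

  Legal : ∀ {n} → ℕ → Word d n → Set
  Legal l []            = ⊤
  Legal l (nothing ∷ w) = Legal l w
  Legal l (just a ∷ w)  = After a l w × Legal l w

  legal? : ∀ {n} l (w : Word d n) → Dec (Legal l w)
  legal? l []            = yes tt
  legal? l (nothing ∷ w) = legal? l w
  legal? l (just a ∷ w)  = after? a l w ×-dec legal? l w

  above⇒stepCond : ∀ a z → Above a z → StepCond (just a) z 1
  above⇒stepCond a nothing  _   = tt
  above⇒stepCond a (just x) a<x = ℕ.s≤s (≡.subst (ℕ._≤ toℕ x) (ℕ.+-comm 1 (toℕ a)) a<x)

  stepCond⇒above : ∀ a z → StepCond (just a) z 1 → Above a z
  stepCond⇒above a nothing  _ = tt
  stepCond⇒above a (just x) h = ≡.subst (ℕ._≤ toℕ x) (ℕ.+-comm (toℕ a) 1) (ℕ.≤-pred h)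

  isInfty⇒stepCond : ∀ (y z : Maybe (Fin d)) m → IsInfty z → StepCond y z m
  isInfty⇒stepCond nothing  z       m _ = tt
  isInfty⇒stepCond (just a) nothing m _ = tt

  stepCond⇒isInfty : ∀ a z {m} → d ℕ.≤ m → StepCond (just a) z m → IsInfty z
  stepCond⇒isInfty a nothing  _   _ = tt
  stepCond⇒isInfty a (just x) {m} d≤m h = ℕ.<-irrefl ≡.refl (begin-strict
    suc (toℕ x)       ≤⟨ toℕ<n x ⟩
    d                 ≤⟨ d≤m ⟩
    m                 ≤⟨ ℕ.m≤n+m m (toℕ a) ⟩
    toℕ a ℕ.+ m       <⟨ ℕ.n<1+n _ ⟩
    suc (toℕ a) ℕ.+ m ≤⟨ h ⟩
    suc (toℕ x)       ∎)
    where open ℕ.≤-Reasoning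

  AfterAt : ∀ {n} → Fin d → ℕ → Word d n → Set
  AfterAt {n} a j w =
    j ℕ.< n ×
    (∀ p → toℕ p ℕ.< j → IsInfty (lookup w p)) ×
    (∀ p → toℕ p ≡ j → StepCond (just a) (lookup w p) 1)

  after⇒afterAt : ∀ {n} a j (w : Word d n) → After a j w → AfterAt a j w
  after⇒afterAt a zero (z ∷ w) h = ℕ.z<s , (λ _ ()) , λ { zero _ → above⇒stepCond a z h ; (suc p) () }
  after⇒afterAt a (suc j) (nothing ∷ w) h with after⇒afterAt a j w h
  ... | j<n , infty , step = ℕ.s<s j<n , infty′ , step′
    where
    infty′ : ∀ p → toℕ p ℕ.< suc j → IsInfty (lookup (nothing ∷ w) p)
    infty′ zero    _         = tt
    infty′ (suc p) (ℕ.s<s p<j) = infty p p<j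
    step′ : ∀ p → toℕ p ≡ suc j → StepCond (just a) (lookup (nothing ∷ w) p) 1
    step′ zero    ()
    step′ (suc p) p≡j = step p (ℕ.suc-injective p≡j)

  afterAt⇒after : ∀ {n} a j (w : Word d n) → AfterAt a j w → After a j w
  afterAt⇒after a zero    (z ∷ w)       (_ , _ , step) = stepCond⇒above a z (step zero ≡.refl)
  afterAt⇒after a (suc j) (nothing ∷ w) (ℕ.s<s j<n , infty , step) =
    afterAt⇒after a j w
      (j<n , (λ p p<j → infty (suc p) (ℕ.s<s p<j)) , λ p p≡j → step (suc p) (≡.cong suc p≡j))
  afterAt⇒after a (suc j) (just x ∷ w)  (_ , infty , _) = infty zero ℕ.z<s

module _ {ℓ : ℕ} (μ : Fin (suc ℓ) → ℕ) {d : ℕ} where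

  -- The conditions of IsAnchor that involve the first letter y of y ∷ w.
  FirstLetterOK : ∀ {n} → Maybe (Fin d) → Word d n → Set
  FirstLetterOK {n} y w =
    (∀ p k → suc (toℕ p) ≡ toℕ k → StepCond y (lookup w p) (μ k)) × (suc n ℕ.≤ ℓ → IsInfty y)

  isAnchor-uncons : ∀ {n} y (w : Word d n) →
                    IsAnchor μ d (suc n) (y ∷ w) → IsAnchor μ d n w × FirstLetterOK y w
  isAnchor-uncons y w (steps , infty) =
    ((λ i j k 1≤k j≡i+k → steps (suc i) (suc j) k 1≤k (≡.cong suc j≡i+k)) ,
     (λ i n≤i+ℓ → infty (suc i) (ℕ.s≤s n≤i+ℓ))) ,
    (λ p k e → steps zero (suc p) k (≡.subst (1 ℕ.≤_) e (ℕ.s≤s ℕ.z≤n)) e) , infty zero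

  isAnchor-cons : ∀ {n} y (w : Word d n) →
                  IsAnchor μ d n w → FirstLetterOK y w → IsAnchor μ d (suc n) (y ∷ w)
  isAnchor-cons {n} y w (steps , infty) (first , short) = steps′ , infty′
    where
    steps′ : ∀ i j k → 1 ℕ.≤ toℕ k → toℕ j ≡ toℕ i ℕ.+ toℕ k →
             StepCond (lookup (y ∷ w) i) (lookup (y ∷ w) j) (μ k)
    steps′ zero    zero    k 1≤k 0≡k = ⊥-elim (ℕ.1+n≰n (≡.subst (1 ℕ.≤_) (≡.sym 0≡k) 1≤k))
    steps′ zero    (suc p) k _   e   = first p k e
    steps′ (suc i) zero    k _   ()
    steps′ (suc i) (suc j) k 1≤k e   = steps i j k 1≤k (ℕ.suc-injective e)
    infty′ : ∀ i → suc n ℕ.≤ toℕ i ℕ.+ ℓ → IsInfty (lookup (y ∷ w) i)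
    infty′ zero    n<ℓ     = short n<ℓ
    infty′ (suc i) n<i+1+ℓ = infty i (ℕ.≤-pred n<i+1+ℓ)

module _ {l : ℕ} (μ : Fin (suc (suc l)) → ℕ) {d : ℕ}
         (μ≥d : ∀ k → toℕ k ℕ.≤ l → d ℕ.≤ μ k)
         (μℓ≡1 : ∀ k → toℕ k ≡ suc l → μ k ≡ 1) where

  firstLetterOK⇒after : ∀ {n} a (w : Word d n) → FirstLetterOK μ (just a) w → After a l w
  firstLetterOK⇒after {n} a w (first , short) = afterAt⇒after a l w (l<n , infty , step)
    where
    l<n : l ℕ.< n
    l<n = ℕ.≤-pred (ℕ.≰⇒> short)
    infty : ∀ p → toℕ p ℕ.< l → IsInfty (lookup w p)
    infty p p<l = stepCond⇒isInfty a (lookup w p) (μ≥d k (≡.subst (ℕ._≤ l) (≡.sym k≡1+p) p<l))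
                    (first p k (≡.sym k≡1+p))
      where
      1+p<2+l : suc (toℕ p) ℕ.< suc (suc l)
      1+p<2+l = ℕ.s<s (ℕ.m<n⇒m<1+n p<l)
      k : Fin (suc (suc l))
      k = fromℕ< 1+p<2+l
      k≡1+p : toℕ k ≡ suc (toℕ p)
      k≡1+p = toℕ-fromℕ< 1+p<2+l
    step : ∀ p → toℕ p ≡ l → StepCond (just a) (lookup w p) 1
    step p p≡l = ≡.subst (StepCond (just a) (lookup w p)) (μℓ≡1 k (toℕ-fromℕ (suc l)))
                   (first p k (≡.trans (≡.cong suc p≡l) (≡.sym (toℕ-fromℕ (suc l)))))
      where
      k : Fin (suc (suc l))
      k = fromℕ (suc l)

  after⇒firstLetterOK : ∀ {n} a (w : Word d n) → After a l w → FirstLetterOK μ (just a) w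
  after⇒firstLetterOK {n} a w h with after⇒afterAt a l w h
  ... | l<n , infty , step = first , short
    where
    first : ∀ p k → suc (toℕ p) ≡ toℕ k → StepCond (just a) (lookup w p) (μ k)
    first p k e
      with ℕ.m≤n⇒m<n∨m≡n (ℕ.≤-pred (≡.subst (ℕ._≤ suc l) (≡.sym e) (ℕ.≤-pred (toℕ<n k))))
    ... | inj₁ p<l = isInfty⇒stepCond _ _ _ (infty p p<l)
    ... | inj₂ p≡l = ≡.subst (StepCond (just a) (lookup w p))
                       (≡.sym (μℓ≡1 k (≡.trans (≡.sym e) (≡.cong suc p≡l)))) (step p p≡l)
    short : suc n ℕ.≤ suc l → ⊥
    short n≤l = ℕ.<-irrefl ≡.refl (ℕ.<-≤-trans l<n (ℕ.≤-pred n≤l))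

  isAnchor⇒legal : ∀ {n} (w : Word d n) → IsAnchor μ d n w → Legal l w
  isAnchor⇒legal []            _ = tt
  isAnchor⇒legal (nothing ∷ w) A = isAnchor⇒legal w (proj₁ (isAnchor-uncons μ nothing w A))
  isAnchor⇒legal (just a ∷ w)  A with isAnchor-uncons μ (just a) w A
  ... | A′ , ok = firstLetterOK⇒after a w ok , isAnchor⇒legal w A′

  legal⇒isAnchor : ∀ {n} (w : Word d n) → Legal l w → IsAnchor μ d n w
  legal⇒isAnchor []            _        = (λ ()) , (λ ())
  legal⇒isAnchor (nothing ∷ w) L        =
    isAnchor-cons μ nothing w (legal⇒isAnchor w L) ((λ _ _ _ → tt) , (λ _ → tt))
  legal⇒isAnchor (just a ∷ w)  (af , L) =
    isAnchor-cons μ (just a) w (legal⇒isAnchor w L) (after⇒firstLetterOK a w af)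

  isAnchor⇔legal : ∀ {n} (w : Word d n) → IsAnchor μ d n w ⇔ Legal l w
  isAnchor⇔legal w = mk⇔ (isAnchor⇒legal w) (legal⇒isAnchor w)

module FiniteSums {c ℓr : Level} (R : CommutativeRing c ℓr) where

  open CommutativeRing R hiding (zero)
  open import Algebra.Properties.Semiring.Sum semiring using (sum; sum-cong-≋; sum-replicate-zero)

  _·if_ : Carrier → Bool → Carrier
  v ·if true  = v
  v ·if false = 0#

  *-·if : ∀ a v b → a * (v ·if b) ≈ (a * v) ·if b
  *-·if a v true  = refl
  *-·if a v false = zeroʳ a

  sum-zero : ∀ {k} (h : Fin k → Carrier) → (∀ x → h x ≈ 0#) → sum h ≈ 0#
  sum-zero {k} h h≈0 = trans (sum-cong-≋ h≈0) (sum-replicate-zero k)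

  sumAbove : ∀ {k} → Fin k → (Fin k → Carrier) → Carrier
  sumAbove zero    h = sum (h ∘ suc)
  sumAbove (suc a) h = sumAbove a (h ∘ suc)

  sum-·if-< : ∀ {k} (a : Fin k) (h : Fin k → Carrier) →
              sum (λ b → h b ·if does (a <? b)) ≈ sumAbove a h
  sum-·if-< zero    h = +-identityˡ _
  sum-·if-< (suc a) h = trans (+-identityˡ _) (sum-·if-< a (h ∘ suc))

  listSum : ∀ {A : Set} → List A → (A → Carrier) → Carrier
  listSum List.[]       f = 0#
  listSum (x List.∷ xs) f = f x + listSum xs f

  listSum-cong : ∀ {A : Set} (xs : List A) {f g : A → Carrier} →
                 (∀ x → f x ≈ g x) → listSum xs f ≈ listSum xs g
  listSum-cong List.[]       f≈g = refl
  listSum-cong (x List.∷ xs) f≈g = +-cong (f≈g x) (listSum-cong xs f≈g)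

  listSum-zero : ∀ {A : Set} (xs : List A) → listSum xs (λ _ → 0#) ≈ 0#
  listSum-zero List.[]       = refl
  listSum-zero (x List.∷ xs) = trans (+-identityˡ _) (listSum-zero xs)

  listSum-*ˡ : ∀ {A : Set} a (xs : List A) (f : A → Carrier) →
               listSum xs (λ x → a * f x) ≈ a * listSum xs f
  listSum-*ˡ a List.[]       f = sym (zeroʳ a)
  listSum-*ˡ a (x List.∷ xs) f = trans (+-congˡ (listSum-*ˡ a xs f)) (sym (distribˡ a _ _))

  listSum-++ : ∀ {A : Set} (xs ys : List A) (f : A → Carrier) →
               listSum (xs List.++ ys) f ≈ listSum xs f + listSum ys f
  listSum-++ List.[]       ys f = sym (+-identityˡ _)
  listSum-++ (x List.∷ xs) ys f = trans (+-congˡ (listSum-++ xs ys f)) (sym (+-assoc _ _ _))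

  listSum-concatMap : ∀ {A B : Set} (g : A → List B) (xs : List A) (f : B → Carrier) →
                      listSum (List.concatMap g xs) f ≈ listSum xs (λ x → listSum (g x) f)
  listSum-concatMap g List.[]       f = refl
  listSum-concatMap g (x List.∷ xs) f =
    trans (listSum-++ (g x) (List.concatMap g xs) f) (+-congˡ (listSum-concatMap g xs f))

  listSum-map : ∀ {A B : Set} (g : A → B) (xs : List A) (f : B → Carrier) →
                listSum (List.map g xs) f ≡ listSum xs (f ∘ g)
  listSum-map g List.[]       f = ≡.refl
  listSum-map g (x List.∷ xs) f = ≡.cong (f (g x) +_) (listSum-map g xs f)

  listSum-tabulate : ∀ {A : Set} {k} (g : Fin k → A) (f : A → Carrier) →
                     listSum (tabulate g) f ≡ sum (f ∘ g)
  listSum-tabulate {k = zero}  g f = ≡.refl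
  listSum-tabulate {k = suc k} g f = ≡.cong (f (g zero) +_) (listSum-tabulate (g ∘ suc) f)

  foldr-listSum : ∀ {A : Set} (step : A → Carrier → Carrier) (f : A → Carrier) →
                  (∀ x acc → step x acc ≈ f x + acc) → ∀ xs → List.foldr step 0# xs ≈ listSum xs f
  foldr-listSum step f step≈ List.[]       = refl
  foldr-listSum step f step≈ (x List.∷ xs) = trans (step≈ x _) (+-congˡ (foldr-listSum step f step≈ xs))

module PowerSeries {c ℓr : Level} (R : CommutativeRing c ℓr) where

  open CommutativeRing R hiding (zero)
  open Series R
  open FiniteSums R using (sumAbove)
  open import Algebra.Properties.Ring ring using (-0#≈0#; -‿+-comm; [y-z]x≈yx-zx)
  open import Algebra.Properties.CommutativeSemigroup +-commutativeSemigroup using (interchange; x∙yz≈xz∙y)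
  open import Algebra.Properties.Semiring.Sum semiring using (sum)
  open import Relation.Binary.Reasoning.Setoid setoid

  sumTo-cong : ∀ n {f g : ℕ → Carrier} → (∀ i → i ℕ.≤ n → f i ≈ g i) →
               sumTo n f ≈ sumTo n g
  sumTo-cong zero    f≈g = f≈g 0 ℕ.z≤n
  sumTo-cong (suc n) f≈g =
    +-cong (sumTo-cong n (λ i i≤n → f≈g i (ℕ.m≤n⇒m≤1+n i≤n))) (f≈g (suc n) ℕ.≤-refl)

  sumTo-+ : ∀ n (f g : ℕ → Carrier) → sumTo n (λ i → f i + g i) ≈ sumTo n f + sumTo n g
  sumTo-+ zero    f g = refl
  sumTo-+ (suc n) f g = trans (+-congʳ (sumTo-+ n f g)) (interchange _ _ _ _)

  sumTo-homo : (h : Carrier → Carrier) → (∀ x y → h (x + y) ≈ h x + h y) →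
               ∀ n (f : ℕ → Carrier) → sumTo n (λ i → h (f i)) ≈ h (sumTo n f)
  sumTo-homo h h-+ zero    f = refl
  sumTo-homo h h-+ (suc n) f = trans (+-congʳ (sumTo-homo h h-+ n f)) (sym (h-+ _ _))

  sumTo-*ˡ : ∀ a n (f : ℕ → Carrier) → sumTo n (λ i → a * f i) ≈ a * sumTo n f
  sumTo-*ˡ a = sumTo-homo (a *_) (distribˡ a)

  sumTo-neg : ∀ n (f : ℕ → Carrier) → sumTo n (λ i → - f i) ≈ - sumTo n f
  sumTo-neg = sumTo-homo -_ (λ x y → sym (-‿+-comm x y))

  sumTo-head : ∀ n (f : ℕ → Carrier) → sumTo (suc n) f ≈ f 0 + sumTo n (λ i → f (suc i))
  sumTo-head zero    f = refl
  sumTo-head (suc n) f = trans (+-congʳ (sumTo-head n f)) (+-assoc _ _ _)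

  sumTo-reverse : ∀ n (f : ℕ → Carrier) → sumTo n f ≈ sumTo n (λ i → f (n ℕ.∸ i))
  sumTo-reverse zero    f = refl
  sumTo-reverse (suc n) f = begin
    sumTo n f + f (suc n)                        ≈⟨ +-congʳ (sumTo-reverse n f) ⟩
    sumTo n (λ i → f (n ℕ.∸ i)) + f (suc n)      ≈⟨ +-comm _ _ ⟩
    f (suc n) + sumTo n (λ i → f (n ℕ.∸ i))      ≈⟨ sumTo-head n (λ i → f (suc n ℕ.∸ i)) ⟨
    sumTo (suc n) (λ i → f (suc n ℕ.∸ i))        ∎

  ⊛-congˡ : ∀ (A : PS) {B B′ : PS} → (∀ i → B i ≈ B′ i) → ∀ n → (A ⊛ B) n ≈ (A ⊛ B′) n
  ⊛-congˡ A B≈B′ n = sumTo-cong n (λ i _ → *-congˡ (B≈B′ (n ℕ.∸ i)))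

  ⊛-congʳ : ∀ {A A′ : PS} (B : PS) → (∀ i → A i ≈ A′ i) → ∀ n → (A ⊛ B) n ≈ (A′ ⊛ B) n
  ⊛-congʳ B A≈A′ n = sumTo-cong n (λ i _ → *-congʳ (A≈A′ i))

  ⊛-comm : ∀ (A B : PS) n → (A ⊛ B) n ≈ (B ⊛ A) n
  ⊛-comm A B n = begin
    (A ⊛ B) n                                          ≈⟨ sumTo-reverse n _ ⟩
    sumTo n (λ i → A (n ℕ.∸ i) * B (n ℕ.∸ (n ℕ.∸ i)))  ≈⟨ sumTo-cong n swap ⟩
    (B ⊛ A) n                                          ∎
    where
    swap : ∀ i → i ℕ.≤ n → A (n ℕ.∸ i) * B (n ℕ.∸ (n ℕ.∸ i)) ≈ B i * A (n ℕ.∸ i)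
    swap i i≤n = trans (*-comm _ _) (*-congʳ (reflexive (≡.cong B (ℕ.m∸[m∸n]≡n i≤n))))

  ⊛-identityˡ : ∀ (A : PS) n → (oneS ⊛ A) n ≈ A n
  ⊛-identityˡ A zero    = *-identityˡ (A 0)
  ⊛-identityˡ A (suc n) = begin
    (oneS ⊛ A) (suc n)                                 ≈⟨ sumTo-head n _ ⟩
    1# * A (suc n) + sumTo n (λ i → 0# * A (n ℕ.∸ i))  ≈⟨ +-cong (*-identityˡ _) (sumTo-*ˡ 0# n _) ⟩
    A (suc n) + 0# * (sumTo n (λ i → A (n ℕ.∸ i)))     ≈⟨ +-congˡ (zeroˡ _) ⟩
    A (suc n) + 0#                                     ≈⟨ +-identityʳ _ ⟩
    A (suc n)                                          ∎

  ⊛-distribʳ-⊕ : ∀ (A B F : PS) n → ((A ⊕ B) ⊛ F) n ≈ ((A ⊛ F) ⊕ (B ⊛ F)) n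
  ⊛-distribʳ-⊕ A B F n =
    trans (sumTo-cong n (λ i _ → distribʳ (F (n ℕ.∸ i)) (A i) (B i))) (sumTo-+ n _ _)

  ⊛-distribʳ-⊖ : ∀ (A B F : PS) n → ((A ⊖ B) ⊛ F) n ≈ ((A ⊛ F) ⊖ (B ⊛ F)) n
  ⊛-distribʳ-⊖ A B F n = begin
    ((A ⊖ B) ⊛ F) n
      ≈⟨ sumTo-cong n (λ i _ → [y-z]x≈yx-zx _ _ _) ⟩
    sumTo n (λ i → A i * F (n ℕ.∸ i) - B i * F (n ℕ.∸ i))
      ≈⟨ sumTo-+ n _ _ ⟩
    (A ⊛ F) n + sumTo n (λ i → - (B i * F (n ℕ.∸ i)))
      ≈⟨ +-congˡ (sumTo-neg n _) ⟩
    (A ⊛ F) n - (B ⊛ F) n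
      ∎

  ·-⊛ : ∀ a (A F : PS) n → ((a · A) ⊛ F) n ≈ (a · (A ⊛ F)) n
  ·-⊛ a A F n = trans (sumTo-cong n (λ i _ → *-assoc a (A i) (F (n ℕ.∸ i)))) (sumTo-*ˡ a n _)

  shift : ℕ → PS → PS
  shift zero    A n       = A n
  shift (suc k) A zero    = 0#
  shift (suc k) A (suc n) = shift k A n

  shift-cong : ∀ k {A B : PS} → (∀ i → A i ≈ B i) → ∀ n → shift k A n ≈ shift k B n
  shift-cong zero    A≈B n       = A≈B n
  shift-cong (suc k) A≈B zero    = refl
  shift-cong (suc k) A≈B (suc n) = shift-cong k A≈B n

  shift-⊛ : ∀ k (A F : PS) n → (shift k A ⊛ F) n ≈ shift k (A ⊛ F) n
  shift-⊛ zero    A F n       = refl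
  shift-⊛ (suc k) A F zero    = zeroˡ (F 0)
  shift-⊛ (suc k) A F (suc n) = begin
    (shift (suc k) A ⊛ F) (suc n)         ≈⟨ sumTo-head n _ ⟩
    0# * F (suc n) + (shift k A ⊛ F) n    ≈⟨ +-cong (zeroˡ _) (shift-⊛ k A F n) ⟩
    0# + shift k (A ⊛ F) n                ≈⟨ +-identityˡ _ ⟩
    shift k (A ⊛ F) n                     ∎

  shift-oneS-diagonal : ∀ k → shift k oneS k ≈ 1#
  shift-oneS-diagonal zero    = refl
  shift-oneS-diagonal (suc k) = shift-oneS-diagonal k

  shift-oneS-offDiagonal : ∀ k n → k ≢ n → shift k oneS n ≈ 0#
  shift-oneS-offDiagonal zero    zero    0≢0 = ⊥-elim (0≢0 ≡.refl)
  shift-oneS-offDiagonal zero    (suc n) _   = refl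
  shift-oneS-offDiagonal (suc k) zero    _   = refl
  shift-oneS-offDiagonal (suc k) (suc n) k≢n = shift-oneS-offDiagonal k n (k≢n ∘ ≡.cong suc)

  xPow≈shift-oneS : ∀ k n → xPow k n ≈ shift k oneS n
  xPow≈shift-oneS k n with k ℕ.≟ n
  ... | yes ≡.refl = sym (shift-oneS-diagonal k)
  ... | no k≢n     = sym (shift-oneS-offDiagonal k n k≢n)

  xPow-⊛ : ∀ k (A : PS) n → (xPow k ⊛ A) n ≈ shift k A n
  xPow-⊛ k A n = begin
    (xPow k ⊛ A) n        ≈⟨ ⊛-congʳ A (xPow≈shift-oneS k) n ⟩
    (shift k oneS ⊛ A) n  ≈⟨ shift-⊛ k oneS A n ⟩
    shift k (oneS ⊛ A) n  ≈⟨ shift-cong k (⊛-identityˡ A) n ⟩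
    shift k A n           ∎

  binomial-⊛ : ∀ k a (A : PS) n → ((oneS ⊕ (a · xPow k)) ⊛ A) n ≈ A n + a * shift k A n
  binomial-⊛ k a A n = begin
    ((oneS ⊕ (a · xPow k)) ⊛ A) n        ≈⟨ ⊛-distribʳ-⊕ oneS (a · xPow k) A n ⟩
    (oneS ⊛ A) n + ((a · xPow k) ⊛ A) n  ≈⟨ +-cong (⊛-identityˡ A n) (·-⊛ a (xPow k) A n) ⟩
    A n + a * (xPow k ⊛ A) n             ≈⟨ +-congˡ (*-congˡ (xPow-⊛ k A n)) ⟩
    A n + a * shift k A n                ∎

  binomial-⊛-assoc : ∀ k a (A F : PS) n →
    (((oneS ⊕ (a · xPow k)) ⊛ A) ⊛ F) n ≈ ((oneS ⊕ (a · xPow k)) ⊛ (A ⊛ F)) n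
  binomial-⊛-assoc k a A F n = begin
    (((oneS ⊕ (a · xPow k)) ⊛ A) ⊛ F) n     ≈⟨ ⊛-congʳ F (binomial-⊛ k a A) n ⟩
    ((A ⊕ (a · shift k A)) ⊛ F) n           ≈⟨ ⊛-distribʳ-⊕ A (a · shift k A) F n ⟩
    (A ⊛ F) n + ((a · shift k A) ⊛ F) n     ≈⟨ +-congˡ (·-⊛ a (shift k A) F n) ⟩
    (A ⊛ F) n + a * (shift k A ⊛ F) n       ≈⟨ +-congˡ (*-congˡ (shift-⊛ k A F n)) ⟩
    (A ⊛ F) n + a * shift k (A ⊛ F) n       ≈⟨ binomial-⊛ k a (A ⊛ F) n ⟨
    ((oneS ⊕ (a · xPow k)) ⊛ (A ⊛ F)) n     ∎

  recurrence⇒reciprocal : ∀ (P F : PS) → F 0 ≈ 1# → (∀ n → F (suc n) ≈ (P ⊛ F) n) →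
                          IsReciprocal F (oneS ⊖ (xPow 1 ⊛ P))
  recurrence⇒reciprocal P F F0≈1 F-suc n = begin
    ((oneS ⊖ (xPow 1 ⊛ P)) ⊛ F) n            ≈⟨ ⊛-distribʳ-⊖ oneS (xPow 1 ⊛ P) F n ⟩
    (oneS ⊛ F) n - ((xPow 1 ⊛ P) ⊛ F) n      ≈⟨ +-cong (⊛-identityˡ F n) (-‿cong (xP-⊛ n)) ⟩
    F n - shift 1 (P ⊛ F) n                  ≈⟨ cancel n ⟩
    oneS n                                   ∎
    where
    xP-⊛ : ∀ n → ((xPow 1 ⊛ P) ⊛ F) n ≈ shift 1 (P ⊛ F) n
    xP-⊛ n = trans (⊛-congʳ F (xPow-⊛ 1 P) n) (shift-⊛ 1 P F n)
    cancel : ∀ n → F n - shift 1 (P ⊛ F) n ≈ oneS n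
    cancel zero    = trans (+-cong F0≈1 -0#≈0#) (+-identityʳ 1#)
    cancel (suc n) = trans (+-congʳ (F-suc n)) (-‿inverseʳ _)

  prodS-tabulate : ∀ {A : Set} {k} (f : A → PS) (g : Fin k → A) →
                   prodS f (tabulate g) ≡ prodS (f ∘ g) (allFin k)
  prodS-tabulate {k = zero}  f g = ≡.refl
  prodS-tabulate {k = suc k} f g = ≡.cong (f (g zero) ⊛_)
    (≡.trans (prodS-tabulate f (g ∘ suc)) (≡.sym (prodS-tabulate (f ∘ g) suc)))

  prodS-allFin-suc : ∀ {k} (f : Fin (suc k) → PS) →
                     prodS f (allFin (suc k)) ≡ f zero ⊛ prodS (f ∘ suc) (allFin k)
  prodS-allFin-suc f = ≡.cong (f zero ⊛_) (prodS-tabulate f suc)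

  prodS-constant : ∀ {k} (f : Fin k → PS) (E : PS) → (∀ a i → f a i ≈ E i) →
                   ∀ n → prodS f (allFin k) n ≈ powS E k n
  prodS-constant {zero}  f E f≈E n = refl
  prodS-constant {suc k} f E f≈E n = begin
    prodS f (allFin (suc k)) n  ≡⟨ ≡.cong (λ P → P n) (prodS-allFin-suc f) ⟩
    (f zero ⊛ Q) n              ≈⟨ ⊛-congʳ Q (f≈E zero) n ⟩
    (E ⊛ Q) n                   ≈⟨ ⊛-congˡ E (prodS-constant (f ∘ suc) E (f≈E ∘ suc)) n ⟩
    (E ⊛ powS E k) n            ∎
    where
    Q : PS
    Q = prodS (f ∘ suc) (allFin k)

  -- Peeling off the smallest index a multiplies the sum over the larger indices by 1 + s_a x^m.
  triangular-⊛ : ∀ m {k} (s : Fin k → Carrier) (V : Fin k → PS) (F : PS) →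
    (∀ a n → V a n ≈ shift m (λ i → F i + sumAbove a (λ b → s b * V b i)) n) →
    ∀ n → F n + sum (λ a → s a * V a n) ≈ (prodS (λ a → oneS ⊕ (s a · xPow m)) (allFin k) ⊛ F) n
  triangular-⊛ m {zero}  s V F V≈ n = trans (+-identityʳ (F n)) (sym (⊛-identityˡ F n))
  triangular-⊛ m {suc k} s V F V≈ n = begin
    F n + (s zero * V zero n + Σ-tail n)     ≈⟨ x∙yz≈xz∙y _ _ _ ⟩
    H n + s zero * V zero n                  ≈⟨ +-congˡ (*-congˡ (V≈ zero n)) ⟩
    H n + s zero * shift m H n               ≈⟨ binomial-⊛ m (s zero) H n ⟨
    (f zero ⊛ H) n                           ≈⟨ ⊛-congˡ (f zero) H≈QF n ⟩
    (f zero ⊛ (Q ⊛ F)) n                     ≈⟨ binomial-⊛-assoc m (s zero) Q F n ⟨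
    ((f zero ⊛ Q) ⊛ F) n                     ≡⟨ ≡.cong (λ P → (P ⊛ F) n) (prodS-allFin-suc f) ⟨
    (prodS f (allFin (suc k)) ⊛ F) n         ∎
    where
    f : Fin (suc k) → PS
    f a = oneS ⊕ (s a · xPow m)
    Q : PS
    Q = prodS (f ∘ suc) (allFin k)
    Σ-tail H : PS
    Σ-tail i = sum (λ b → s (suc b) * V (suc b) i)
    H i = F i + Σ-tail i
    H≈QF : ∀ i → H i ≈ (Q ⊛ F) i
    H≈QF = triangular-⊛ m (s ∘ suc) (V ∘ suc) F (V≈ ∘ suc)

  prodS-specS : ∀ k d′ s₀ n →
    prodS (λ r → oneS ⊕ (specS s₀ r · xPow k)) (allFin (suc d′)) n ≈
    (powS (oneS ⊕ xPow k) d′ ⊛ (oneS ⊕ (s₀ · xPow k))) n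
  prodS-specS k d′ s₀ n = begin
    prodS f (allFin (suc d′)) n               ≡⟨ ≡.cong (λ P → P n) (prodS-allFin-suc f) ⟩
    (f zero ⊛ prodS (f ∘ suc) (allFin d′)) n
      ≈⟨ ⊛-congˡ (f zero) (prodS-constant (f ∘ suc) E 1·x≈x) n ⟩
    (f zero ⊛ powS E d′) n                    ≈⟨ ⊛-comm (f zero) (powS E d′) n ⟩
    (powS E d′ ⊛ f zero) n                    ∎
    where
    f : Fin (suc d′) → PS
    f r = oneS ⊕ (specS s₀ r · xPow k)
    E : PS
    E = oneS ⊕ xPow k
    1·x≈x : ∀ r i → f (suc r) i ≈ E i
    1·x≈x r i = +-congˡ (*-identityˡ (xPow k i))

module AnchorSeries {c ℓr : Level} (R : CommutativeRing c ℓr)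
                    {d : ℕ} (s : Fin d → CommutativeRing.Carrier R) where

  open CommutativeRing R hiding (zero)
  open Series R
  open FiniteSums R
  open PowerSeries R
  open import Algebra.Properties.Semiring.Sum semiring using (sum; sum-cong-≋; sum-cong-≗)
  open import Relation.Binary.Reasoning.Setoid setoid

  listSum-allWords-suc : ∀ n (f : Word d (suc n) → Carrier) →
    listSum (allWords d (suc n)) f ≈
    listSum (allWords d n) (λ w → f (nothing ∷ w)) +
    sum (λ x → listSum (allWords d n) (λ w → f (just x ∷ w)))
  listSum-allWords-suc n f = begin
    listSum (allWords d (suc n)) f
      ≈⟨ listSum-concatMap extend (letters d) f ⟩
    G nothing + listSum (List.map just (allFin d)) G
      ≡⟨ ≡.cong (G nothing +_)
           (≡.trans (listSum-map just (allFin d) G) (listSum-tabulate (λ x → x) (G ∘ just))) ⟩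
    G nothing + sum (G ∘ just)
      ≡⟨ ≡.cong₂ _+_ (G≡ nothing) (sum-cong-≗ (G≡ ∘ just)) ⟩
    listSum (allWords d n) (λ w → f (nothing ∷ w)) +
    sum (λ x → listSum (allWords d n) (λ w → f (just x ∷ w)))
      ∎
    where
    extend : Maybe (Fin d) → List (Word d (suc n))
    extend y = List.map (y ∷_) (allWords d n)
    G : Maybe (Fin d) → Carrier
    G y = listSum (extend y) f
    G≡ : ∀ y → G y ≡ listSum (allWords d n) (λ w → f (y ∷ w))
    G≡ y = listSum-map (y ∷_) (allWords d n) f

  wsum : ∀ n {P : Word d n → Set} → (∀ w → Dec (P w)) → Carrier
  wsum n P? = listSum (allWords d n) (λ w → weight s w ·if does (P? w))

  wsum-cong : ∀ n {P Q : Word d n → Set} (P? : ∀ w → Dec (P w)) (Q? : ∀ w → Dec (Q w)) →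
              (∀ w → P w ⇔ Q w) → wsum n P? ≈ wsum n Q?
  wsum-cong n P? Q? P⇔Q =
    listSum-cong (allWords d n) λ w →
      reflexive (≡.cong (weight s w ·if_) (does-⇔ (P⇔Q w) (P? w) (Q? w)))

  wsum-×-dec : ∀ n {A : Set} {Q : Word d n → Set} (A? : Dec A) (Q? : ∀ w → Dec (Q w)) →
               wsum n (λ w → A? ×-dec Q? w) ≈ wsum n Q? ·if does A?
  wsum-×-dec n (yes _) Q? = refl
  wsum-×-dec n (no _)  Q? = listSum-zero (allWords d n)

  wsum-∷ : ∀ n {P : Word d (suc n) → Set} (P? : ∀ w → Dec (P w)) →
           wsum (suc n) P? ≈
           wsum n (λ w → P? (nothing ∷ w)) + sum (λ x → s x * wsum n (λ w → P? (just x ∷ w)))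
  wsum-∷ n P? = trans (listSum-allWords-suc n _) (+-congˡ (sum-cong-≋ λ x →
    trans (listSum-cong (allWords d n) (λ w → sym (*-·if (s x) (weight s w) (does (P? (just x ∷ w))))))
          (listSum-*ˡ (s x) (allWords d n) (λ w → weight s w ·if does (P? (just x ∷ w))))))

  module _ (l : ℕ) where

    legalCount : PS
    legalCount n = wsum n (legal? l)

    afterCount : Fin d → ℕ → PS
    afterCount a j n = wsum n (λ w → after? a j w ×-dec legal? l w)

    afterCount-zero : ∀ a j → afterCount a j 0 ≈ 0#
    afterCount-zero a j = +-identityʳ 0#

    afterCount-suc-suc : ∀ a j n → afterCount a (suc j) (suc n) ≈ afterCount a j n
    afterCount-suc-suc a j n = begin
      afterCount a (suc j) (suc n)
        ≈⟨ wsum-∷ n (λ w → after? a (suc j) w ×-dec legal? l w) ⟩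
      afterCount a j n + sum (λ x → s x * listSum (allWords d n) (λ _ → 0#))
        ≈⟨ +-congˡ (sum-zero _ λ x → trans (*-congˡ (listSum-zero (allWords d n))) (zeroʳ (s x))) ⟩
      afterCount a j n + 0#
        ≈⟨ +-identityʳ _ ⟩
      afterCount a j n
        ∎

    afterCount-zero-suc : ∀ a n →
      afterCount a zero (suc n) ≈ legalCount n + sumAbove a (λ b → s b * afterCount b l n)
    afterCount-zero-suc a n = begin
      afterCount a zero (suc n)
        ≈⟨ wsum-∷ n (λ w → after? a zero w ×-dec legal? l w) ⟩
      legalCount n + sum (λ b → s b * wsum n (λ w → (a <? b) ×-dec (after? b l w ×-dec legal? l w)))
        ≈⟨ +-congˡ (sum-cong-≋ λ b →
             *-congˡ (wsum-×-dec n (a <? b) (λ w → after? b l w ×-dec legal? l w))) ⟩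
      legalCount n + sum (λ b → s b * (afterCount b l n ·if does (a <? b)))
        ≈⟨ +-congˡ (sum-cong-≋ λ b → *-·if (s b) (afterCount b l n) (does (a <? b))) ⟩
      legalCount n + sum (λ b → (s b * afterCount b l n) ·if does (a <? b))
        ≈⟨ +-congˡ (sum-·if-< a (λ b → s b * afterCount b l n)) ⟩
      legalCount n + sumAbove a (λ b → s b * afterCount b l n)
        ∎

    afterCount≈shift : ∀ a j n →
      afterCount a j n ≈ shift (suc j) (λ i → legalCount i + sumAbove a (λ b → s b * afterCount b l i)) n
    afterCount≈shift a j       zero    = afterCount-zero a j
    afterCount≈shift a zero    (suc n) = afterCount-zero-suc a n
    afterCount≈shift a (suc j) (suc n) = trans (afterCount-suc-suc a j n) (afterCount≈shift a j n)

    legalCount-zero : legalCount 0 ≈ 1#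
    legalCount-zero = +-identityʳ 1#

    legalCount-suc : ∀ n →
      legalCount (suc n) ≈ (prodS (λ a → oneS ⊕ (s a · xPow (suc l))) (allFin d) ⊛ legalCount) n
    legalCount-suc n = trans (wsum-∷ n (legal? l))
      (triangular-⊛ (suc l) s (λ a → afterCount a l) legalCount (λ a → afterCount≈shift a l) n)

  -- S folds allWords with a step function local to its definition; S-step names it.
  S-step : ∀ {ℓ} (μ : Fin (suc ℓ) → ℕ) n →
           Σ (Word d n → Carrier → Carrier) λ step → S μ d n s ≡ List.foldr step 0# (allWords d n)
  S-step μ n = _ , ≡.refl

  S-step-≈ : ∀ {ℓ} (μ : Fin (suc ℓ) → ℕ) {n} w acc →
             proj₁ (S-step μ n) w acc ≈ weight s w ·if does (isAnchor? μ d n w) + acc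
  S-step-≈ μ {n} w acc with isAnchor? μ d n w
  ... | yes A = +-congʳ (reflexive (≡.cong (weight s w ·if_) (≡.sym (dec-true (isAnchor? μ d n w) A))))
  ... | no ¬A = trans (sym (+-identityˡ acc))
    (+-congʳ (reflexive (≡.cong (weight s w ·if_) (≡.sym (dec-false (isAnchor? μ d n w) ¬A)))))

  S≈wsum : ∀ {ℓ} (μ : Fin (suc ℓ) → ℕ) n → S μ d n s ≈ wsum n (isAnchor? μ d n)
  S≈wsum μ n = foldr-listSum _ _ (S-step-≈ μ) (allWords d n)

  module _ {l : ℕ} (μ : Fin (suc (suc l)) → ℕ)
           (μ≥d : ∀ k → toℕ k ℕ.≤ l → d ℕ.≤ μ k)
           (μℓ≡1 : ∀ k → toℕ k ≡ suc l → μ k ≡ 1) where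

    S≈legalCount : ∀ n → S μ d n s ≈ legalCount l n
    S≈legalCount n = trans (S≈wsum μ n)
      (wsum-cong n (isAnchor? μ d n) (legal? l) (isAnchor⇔legal μ μ≥d μℓ≡1))

    S-zero : S μ d 0 s ≈ 1#
    S-zero = trans (S≈legalCount 0) (legalCount-zero l)

    S-suc : ∀ n → S μ d (suc n) s ≈
                  (prodS (λ a → oneS ⊕ (s a · xPow (suc l))) (allFin d) ⊛ (λ i → S μ d i s)) n
    S-suc n = trans (S≈legalCount (suc n))
      (trans (legalCount-suc l n) (⊛-congˡ _ (λ i → sym (S≈legalCount i)) n))

    S-reciprocal : ∀ (P : PS) →
                   (∀ n → prodS (λ a → oneS ⊕ (s a · xPow (suc l))) (allFin d) n ≈ P n) →
                   IsReciprocal (λ n → S μ d n s) (oneS ⊖ (xPow 1 ⊛ P))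
    S-reciprocal P P≈ = recurrence⇒reciprocal P (λ n → S μ d n s) S-zero
      (λ n → trans (S-suc n) (⊛-congʳ (λ i → S μ d i s) P≈ n))

theorem5p4 : ∀ {c ℓr : Level} (R : CommutativeRing c ℓr) →
        let open Series R in
    (ℓ : ℕ) (μ : Fin (suc ℓ) → ℕ) (d : ℕ) →
    (∀ (i j : Fin (suc ℓ)) → toℕ i ≤ toℕ j → μ j ≤ μ i) →
    (∀ (i : Fin (suc ℓ)) → 1 ≤ μ i) →
    1 ≤ ℓ → 1 ≤ d → d ≤ μ zero →
    (∀ (i : Fin (suc ℓ)) → toℕ i ≡ ℓ → μ i ≡ 1) →
    (∀ (i : Fin (suc ℓ)) → suc (toℕ i) ≡ ℓ → d ≤ μ i) →
    (∀ (s : Fin d → CommutativeRing.Carrier R) →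
      IsReciprocal (λ n → S μ d n s)
        (oneS ⊖ (xPow 1 ⊛ prodS (λ r → oneS ⊕ (s r · xPow ℓ)) (allFin d))))
    ×
    (∀ (d′ : ℕ) → d ≡ suc d′ → ∀ (s₀ : CommutativeRing.Carrier R) →
      IsReciprocal (λ n → S μ (suc d′) n (specS s₀))
        (oneS ⊖ (xPow 1 ⊛ (powS (oneS ⊕ xPow ℓ) d′ ⊛ (oneS ⊕ (s₀ · xPow ℓ))))))
-- Only μ₁,…,μ_ℓ enter the anchor condition.
theorem5p4 R zero    μ d _        _ () _ _ _    _
theorem5p4 R (suc l) μ d antitone _ _ _ _ μℓ≡1 penultimate =
  (λ s → S-reciprocal s μ μ≥d μℓ≡1 _ (λ _ → refl)) ,
  (λ { d′ ≡.refl s₀ → S-reciprocal (specS s₀) μ μ≥d μℓ≡1 _ (prodS-specS (suc l) d′ s₀) })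
  where
  open CommutativeRing R using (refl)
  open Series R using (specS)
  open PowerSeries R
  open AnchorSeries R

  μ≥d : ∀ k → toℕ k ℕ.≤ l → d ℕ.≤ μ k
  μ≥d k k≤l = ℕ.≤-trans (penultimate p (≡.cong suc p≡l))
                        (antitone k p (≡.subst (toℕ k ℕ.≤_) (≡.sym p≡l) k≤l))
    where
    l<2+l : l ℕ.< suc (suc l)
    l<2+l = ℕ.m<n⇒m<1+n (ℕ.n<1+n l)
    p : Fin (suc (suc l))
    p = fromℕ< l<2+l
    p≡l : toℕ p ≡ l
    p≡l = toℕ-fromℕ< l<2+l
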